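{- Let $q\geq 3$ be odd, let $D$ be the dihedral group of order $2q$ with generators $\sigma,\rho$ satisfying $\sigma^2=\rho^q=1$, $\sigma\rho=\rho^{ -1}\sigma$, and let $G=\langle\rho\rangle$, $\Sigma=\langle\sigma\rangle$, $\Sigma'=\langle\sigma\rho\rangle$. Let $B$ be a finite $D$-module (written additively) on which multiplication by $q$ is an automorphism. Then there is a direct sum decomposition \[ B/B^D\cong B^G/B^D\oplus\bigl(B^\Sigma+B^{\Sigma'}\bigr)/B^D, \] and consequently \[ B/B^G\cong B^\Sigma/B^D\oplus B^{\Sigma'}/B^D. \]
   Context: $B^H$ denotes the submodule of $H$-invariants. -}

module Defs where

open import Level using (Level; _⊔_) renaming (suc to lsuc)
open import Data.Nat using (ℕ; zero; suc; _∸_)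
open import Data.Bool using (Bool; true; false; if_then_else_)
open import Data.Fin using (Fin)
open import Data.Product using (Σ; ∃; ∃-syntax; _×_; _,_; proj₁; proj₂)
open import Data.Unit.Polymorphic using (⊤)
open import Relation.Binary using (Rel)
open import Relation.Binary.PropositionalEquality using (_≡_)
open import Algebra.Bundles using (AbelianGroup)
import Algebra.Properties.CommutativeSemigroup as CSProps

iter : ∀ {a} {A : Set a} → ℕ → (A → A) → A → A
iter zero    f x = x
iter (suc n) f x = f (iter n f x)

-- A module over the dihedral group D = ⟨ σ , ρ ∣ σ² = ρ^q = 1 , σρ = ρ⁻¹σ ⟩
-- (order 2q), i.e. an abelian group B (written with _∙_, ε, _⁻¹, playing
-- the role of +, 0, -) together with additive automorphisms σ, ρ satisfying
-- the defining relations of D (ρ⁻¹ = ρ^(q-1)).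
record DModule (c ℓ : Level) (q : ℕ) : Set (lsuc (c ⊔ ℓ)) where
  field
    B : AbelianGroup c ℓ
  open AbelianGroup B public
  field
    σ ρ    : Carrier → Carrier
    σ-cong : ∀ {x y} → x ≈ y → σ x ≈ σ y
    ρ-cong : ∀ {x y} → x ≈ y → ρ x ≈ ρ y
    σ-hom  : ∀ x y → σ (x ∙ y) ≈ σ x ∙ σ y
    ρ-hom  : ∀ x y → ρ (x ∙ y) ≈ ρ x ∙ ρ y
    σ²≈1   : ∀ x → σ (σ x) ≈ x
    ρ^q≈1  : ∀ x → iter q ρ x ≈ x
    σρ≈ρ⁻¹σ : ∀ x → σ (ρ x) ≈ iter (q ∸ 1) ρ (σ x)

record Grp (a b : Level) : Set (lsuc (a ⊔ b)) where
  field
    Carrier : Set a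
    _≈_     : Rel Carrier b
    _+_     : Carrier → Carrier → Carrier

Iso : ∀ {a b a' b'} → Grp a b → Grp a' b' → Set (a ⊔ b ⊔ a' ⊔ b')
Iso A B' =
  Σ (A.Carrier → B.Carrier) λ f →
      (∀ {x y} → x A.≈ y → f x B.≈ f y)
    × (∀ x y → f (x A.+ y) B.≈ (f x B.+ f y))
    × (∀ {x y} → f x B.≈ f y → x A.≈ y)
    × (∀ z → ∃[ x ] (f x B.≈ z))
  where
    module A = Grp A
    module B = Grp B'

_⊕_ : ∀ {a b a' b'} → Grp a b → Grp a' b' → Grp (a ⊔ a') (b ⊔ b')
A ⊕ B' = record
  { Carrier = A.Carrier × B.Carrier
  ; _≈_ = λ u v → (proj₁ u A.≈ proj₁ v) × (proj₂ u B.≈ proj₂ v)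
  ; _+_ = λ u v → (proj₁ u A.+ proj₁ v , proj₂ u B.+ proj₂ v)
  }
  where
    module A = Grp A
    module B = Grp B'

module _ {c ℓ : Level} {q : ℕ} (M : DModule c ℓ q) where
  open DModule M

  mulℕ : ℕ → Carrier → Carrier
  mulℕ zero    x = ε
  mulℕ (suc n) x = x ∙ mulℕ n x

  IsFinite : Set (c ⊔ ℓ)
  IsFinite = ∃[ n ] Σ (Fin n → Carrier) λ f →
      (∀ i j → f i ≈ f j → i ≡ j) × (∀ x → ∃[ i ] (f i ≈ x))

  -- multiplication by n is an automorphism of B (it is always additive)
  MulIsAuto : ℕ → Set (c ⊔ ℓ)
  MulIsAuto n = (∀ x y → mulℕ n x ≈ mulℕ n y → x ≈ y) × (∀ y → ∃[ x ] (mulℕ n x ≈ y))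

  -- action of the element ρ^i σ^e of D  (every element of D has this form)
  act : ℕ → Bool → Carrier → Carrier
  act i e x = iter i ρ (if e then σ x else x)

  Inv⟨_⟩ : (Carrier → Carrier) → Carrier → Set ℓ
  Inv⟨ f ⟩ x = ∀ n → iter n f x ≈ x

  B^D B^G B^Σ B^Σ' : Carrier → Set ℓ
  B^D  x = ∀ i e → act i e x ≈ x
  B^G  = Inv⟨ ρ ⟩
  B^Σ  = Inv⟨ σ ⟩
  B^Σ' = Inv⟨ (λ y → σ (ρ y)) ⟩

  B^Σ+B^Σ' : Carrier → Set (c ⊔ ℓ)
  B^Σ+B^Σ' x = ∃[ a ] ∃[ b ] (B^Σ a × B^Σ' b × x ≈ a ∙ b)

  private
    iter-hom : (f : Carrier → Carrier) → (∀ {x y} → x ≈ y → f x ≈ f y)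
             → (∀ x y → f (x ∙ y) ≈ f x ∙ f y)
             → ∀ n x y → iter n f (x ∙ y) ≈ iter n f x ∙ iter n f y
    iter-hom f fc fh zero x y = refl
    iter-hom f fc fh (suc n) x y = trans (fc (iter-hom f fc fh n x y)) (fh _ _)

    σρ-cong : ∀ {x y} → x ≈ y → σ (ρ x) ≈ σ (ρ y)
    σρ-cong p = σ-cong (ρ-cong p)
    σρ-hom : ∀ x y → σ (ρ (x ∙ y)) ≈ σ (ρ x) ∙ σ (ρ y)
    σρ-hom x y = trans (σ-cong (ρ-hom x y)) (σ-hom _ _)

    cyc-closed : (f : Carrier → Carrier) → (∀ {x y} → x ≈ y → f x ≈ f y)
               → (∀ x y → f (x ∙ y) ≈ f x ∙ f y)
               → ∀ {x y} → Inv⟨ f ⟩ x → Inv⟨ f ⟩ y → Inv⟨ f ⟩ (x ∙ y)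
    cyc-closed f fc fh px py n = trans (iter-hom f fc fh n _ _) (∙-cong (px n) (py n))

  G-closed : ∀ {x y} → B^G x → B^G y → B^G (x ∙ y)
  G-closed = cyc-closed ρ ρ-cong ρ-hom
  Σ-closed : ∀ {x y} → B^Σ x → B^Σ y → B^Σ (x ∙ y)
  Σ-closed = cyc-closed σ σ-cong σ-hom
  Σ'-closed : ∀ {x y} → B^Σ' x → B^Σ' y → B^Σ' (x ∙ y)
  Σ'-closed = cyc-closed (λ y → σ (ρ y)) σρ-cong σρ-hom

  Σ+Σ'-closed : ∀ {x y} → B^Σ+B^Σ' x → B^Σ+B^Σ' y → B^Σ+B^Σ' (x ∙ y)
  Σ+Σ'-closed (a , b , pa , pb , ex) (c' , d , pc , pd , ey) =
    a ∙ c' , b ∙ d , Σ-closed pa pc , Σ'-closed pb pd ,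
    trans (∙-cong ex ey) (CSProps.interchange commutativeSemigroup a b c' d)

  Quot : (K : Carrier → Set ℓ) → Grp c ℓ
  Quot K = record { Carrier = Carrier ; _≈_ = λ x y → K (x ∙ y ⁻¹) ; _+_ = _∙_ }

  SubQuot : ∀ {h} (H : Carrier → Set h)
          → (∀ {x y} → H x → H y → H (x ∙ y))
          → (K : Carrier → Set ℓ) → Grp (c ⊔ h) ℓ
  SubQuot H cl K = record
    { Carrier = Σ Carrier H
    ; _≈_ = λ u v → K (proj₁ u ∙ proj₁ v ⁻¹)
    ; _+_ = λ u v → (proj₁ u ∙ proj₁ v , cl (proj₂ u) (proj₂ v))
    }

{-# OPTIONS --safe #-}

-- Since multiplication by q is invertible, the average e = q⁻¹ Σ_{i<q} ρⁱ is a projection onto B^G,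
-- and its complement factors through 1 - ρ: (1 - ρ) Σ_{n<q} Σ_{i<n} ρⁱ = q - Σ_{i<q} ρⁱ.
-- Every value of 1 - ρ splits as  y - ρy = -(σρy + ρy) + (σρy + y),  a σ-fixed plus a σρ-fixed
-- element, since z + gz is fixed by any involution g.  Hence x ↦ (e x, x - e x) and x ↦ (the two
-- summands of x - e x) give the two isomorphisms; modulo B^D they are well defined and bijective
-- because e commutes with σ (so e maps B^Σ and B^Σ' into B^D) and B^Σ ∩ B^Σ' = B^D.
module Submission where

open import Defs
open import Level using (Level; _⊔_)
open import Data.Nat using (ℕ; zero; suc; _≤_; _%_)
open import Data.Bool using (true; false)
open import Data.Product using (Σ; ∃-syntax; _,_; proj₁; proj₂; _×_)
open import Relation.Binary.PropositionalEquality as ≡ using (_≡_)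
open import Algebra.Bundles using (AbelianGroup)

iter-commute : ∀ {a} {A : Set a} (f : A → A) n x → iter n f (f x) ≡ f (iter n f x)
iter-commute f zero    x = ≡.refl
iter-commute f (suc n) x = ≡.cong f (iter-commute f n x)

module Endomorphisms {c ℓ : Level} (G : AbelianGroup c ℓ) where
  open AbelianGroup G
  open import Algebra.Properties.AbelianGroup G
  open import Algebra.Properties.CommutativeSemigroup commutativeSemigroup
    using (interchange; xy∙z≈xz∙y)
  open import Algebra.Properties.CommutativeMonoid.Mult commutativeMonoid
    using (×-congʳ; ×-distrib-+) renaming (_×_ to _·_)
  open import Relation.Binary.Reasoning.Setoid setoid

  -‿interchange : ∀ a b c d → (a - b) ∙ (c - d) ≈ (a ∙ c) - (b ∙ d)
  -‿interchange a b c d = trans (interchange a (b ⁻¹) c (d ⁻¹)) (∙-congˡ (⁻¹-∙-comm b d))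

  -‿exchange : ∀ {a b c d} → a ∙ b ≈ c ∙ d → c - b ≈ a - d
  -‿exchange {a} {b} {c} {d} ab≈cd = begin
    c - b                ≈⟨ //-rightDividesʳ d (c - b) ⟨
    (c - b) ∙ d - d      ≈⟨ ∙-congʳ (xy∙z≈xz∙y c (b ⁻¹) d) ⟩
    (c ∙ d) - b - d      ≈⟨ ∙-congʳ (∙-congʳ ab≈cd) ⟨
    (a ∙ b) - b - d      ≈⟨ ∙-congʳ (//-rightDividesʳ b a) ⟩
    a - d                ∎

  record IsEndomorphism (f : Carrier → Carrier) : Set (c ⊔ ℓ) where
    field
      cong : ∀ {x y} → x ≈ y → f x ≈ f y
      homo : ∀ x y → f (x ∙ y) ≈ f x ∙ f y

    ε-homo : f ε ≈ ε
    ε-homo = begin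
      f ε                ≈⟨ //-rightDividesʳ (f ε) (f ε) ⟨
      (f ε ∙ f ε) - f ε  ≈⟨ ∙-congʳ (homo ε ε) ⟨
      f (ε ∙ ε) - f ε    ≈⟨ ∙-congʳ (cong (identityˡ ε)) ⟩
      f ε - f ε          ≈⟨ inverseʳ (f ε) ⟩
      ε                  ∎

    ⁻¹-homo : ∀ x → f (x ⁻¹) ≈ f x ⁻¹
    ⁻¹-homo x = inverseʳ-unique (f x) (f (x ⁻¹))
      (trans (sym (homo x (x ⁻¹))) (trans (cong (inverseʳ x)) ε-homo))

    -‿homo : ∀ x y → f (x - y) ≈ f x - f y
    -‿homo x y = trans (homo x (y ⁻¹)) (∙-congˡ (⁻¹-homo y))

    ·-homo : ∀ n x → f (n · x) ≈ n · f x
    ·-homo zero    x = ε-homo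
    ·-homo (suc n) x = trans (homo x (n · x)) (∙-congˡ (·-homo n x))

  open IsEndomorphism

  id-endo : IsEndomorphism (λ x → x)
  id-endo = record { cong = λ p → p ; homo = λ _ _ → refl }

  ∘-endo : ∀ {f g} → IsEndomorphism f → IsEndomorphism g → IsEndomorphism (λ x → f (g x))
  ∘-endo f g = record
    { cong = λ p → cong f (cong g p)
    ; homo = λ x y → trans (cong f (homo g x y)) (homo f _ _)
    }

  ∙-endo : ∀ {f g} → IsEndomorphism f → IsEndomorphism g → IsEndomorphism (λ x → f x ∙ g x)
  ∙-endo f g = record
    { cong = λ p → ∙-cong (cong f p) (cong g p)
    ; homo = λ x y → trans (∙-cong (homo f x y) (homo g x y)) (interchange _ _ _ _)
    }

  -‿endo : ∀ {f g} → IsEndomorphism f → IsEndomorphism g → IsEndomorphism (λ x → f x - g x)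
  -‿endo f g = record
    { cong = λ p → ∙-cong (cong f p) (⁻¹-cong (cong g p))
    ; homo = λ x y → trans (∙-cong (homo f x y) (⁻¹-cong (homo g x y)))
                           (sym (-‿interchange _ _ _ _))
    }

  ⁻¹-endo : ∀ {f} → IsEndomorphism f → IsEndomorphism (λ x → f x ⁻¹)
  ⁻¹-endo f = record
    { cong = λ p → ⁻¹-cong (cong f p)
    ; homo = λ x y → trans (⁻¹-cong (homo f x y)) (sym (⁻¹-∙-comm _ _))
    }

  ·-endo : ∀ n → IsEndomorphism (n ·_)
  ·-endo n = record { cong = ×-congʳ n ; homo = λ x y → ×-distrib-+ x y n }

  iter-endo : ∀ {f} → IsEndomorphism f → ∀ n → IsEndomorphism (iter n f)
  iter-endo f zero    = id-endo
  iter-endo f (suc n) = ∘-endo f (iter-endo f n)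

  Fix : (Carrier → Carrier) → Carrier → Set ℓ
  Fix f x = f x ≈ x

  module _ {f : Carrier → Carrier} (f-endo : IsEndomorphism f) where

    Fix-resp : ∀ {x y} → x ≈ y → Fix f x → Fix f y
    Fix-resp x≈y fx = trans (cong f-endo (sym x≈y)) (trans fx x≈y)

    Fix-ε : Fix f ε
    Fix-ε = ε-homo f-endo

    Fix-∙ : ∀ {x y} → Fix f x → Fix f y → Fix f (x ∙ y)
    Fix-∙ fx fy = trans (homo f-endo _ _) (∙-cong fx fy)

    Fix-⁻¹ : ∀ {x} → Fix f x → Fix f (x ⁻¹)
    Fix-⁻¹ fx = trans (⁻¹-homo f-endo _) (⁻¹-cong fx)

    Fix-‿- : ∀ {x y} → Fix f x → Fix f y → Fix f (x - y)
    Fix-‿- fx fy = Fix-∙ fx (Fix-⁻¹ fy)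

    Fix⇒iter-Fix : ∀ {x} → Fix f x → ∀ n → iter n f x ≈ x
    Fix⇒iter-Fix fx zero    = refl
    Fix⇒iter-Fix fx (suc n) = trans (cong f-endo (Fix⇒iter-Fix fx n)) fx

    involution⇒Fix-∙ : (∀ z → f (f z) ≈ z) → ∀ z → Fix f (f z ∙ z)
    involution⇒Fix-∙ ff z = trans (homo f-endo _ _) (trans (∙-congʳ (ff z)) (comm z (f z)))

  module Division (n : ℕ)
    (·-injective : ∀ x y → n · x ≈ n · y → x ≈ y)
    (·-surjective : ∀ y → ∃[ x ] (n · x ≈ y))
    where

    divide : Carrier → Carrier
    divide y = proj₁ (·-surjective y)

    ·-divide : ∀ y → n · divide y ≈ y
    ·-divide y = proj₂ (·-surjective y)

    divide-· : ∀ x → divide (n · x) ≈ x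
    divide-· x = ·-injective _ _ (·-divide (n · x))

    divide-endo : IsEndomorphism divide
    divide-endo = record
      { cong = λ {x} {y} x≈y →
          ·-injective _ _ (trans (·-divide x) (trans x≈y (sym (·-divide y))))
      ; homo = λ x y → ·-injective _ _ (begin
          n · divide (x ∙ y)            ≈⟨ ·-divide (x ∙ y) ⟩
          x ∙ y                         ≈⟨ ∙-cong (·-divide x) (·-divide y) ⟨
          n · divide x ∙ n · divide y   ≈⟨ homo (·-endo n) _ _ ⟨
          n · (divide x ∙ divide y)     ∎)
      }

    divide-commute : ∀ {h} → IsEndomorphism h → ∀ x → divide (h x) ≈ h (divide x)
    divide-commute {h} h-endo x = ·-injective _ _ (begin
      n · divide (h x)  ≈⟨ ·-divide (h x) ⟩
      h x               ≈⟨ cong h-endo (·-divide x) ⟨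
      h (n · divide x)  ≈⟨ ·-homo h-endo n (divide x) ⟩
      n · h (divide x)  ∎)

  module Averaging (q : ℕ) {ρ : Carrier → Carrier} (ρ-endo : IsEndomorphism ρ)
    (ρ^q≈id : ∀ x → iter q ρ x ≈ x)
    (·-injective : ∀ x y → q · x ≈ q · y → x ≈ y)
    (·-surjective : ∀ y → ∃[ x ] (q · x ≈ y))
    where

    open Division q ·-injective ·-surjective

    orbitSum : ℕ → Carrier → Carrier
    orbitSum zero    x = ε
    orbitSum (suc n) x = x ∙ orbitSum n (ρ x)

    orbitSum-endo : ∀ n → IsEndomorphism (orbitSum n)
    orbitSum-endo zero    = record { cong = λ _ → refl ; homo = λ _ _ → sym (identityˡ ε) }
    orbitSum-endo (suc n) = record
      { cong = λ p → ∙-cong p (cong (orbitSum-endo n) (cong ρ-endo p))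
      ; homo = λ x y → trans (∙-congˡ (trans (cong (orbitSum-endo n) (homo ρ-endo x y))
                                             (homo (orbitSum-endo n) _ _)))
                             (interchange _ _ _ _)
      }

    ρ-orbitSum : ∀ n x → ρ (orbitSum n x) ≈ orbitSum n (ρ x)
    ρ-orbitSum zero    x = ε-homo ρ-endo
    ρ-orbitSum (suc n) x = trans (homo ρ-endo _ _) (∙-congˡ (ρ-orbitSum n (ρ x)))

    orbitSum-sucʳ : ∀ n x → orbitSum (suc n) x ≈ orbitSum n x ∙ iter n ρ x
    orbitSum-sucʳ zero    x = comm x ε
    orbitSum-sucʳ (suc n) x = begin
      x ∙ orbitSum (suc n) (ρ x)               ≈⟨ ∙-congˡ (orbitSum-sucʳ n (ρ x)) ⟩
      x ∙ (orbitSum n (ρ x) ∙ iter n ρ (ρ x))  ≈⟨ assoc _ _ _ ⟨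
      x ∙ orbitSum n (ρ x) ∙ iter n ρ (ρ x)    ≡⟨ ≡.cong (orbitSum (suc n) x ∙_) (iter-commute ρ n x) ⟩
      x ∙ orbitSum n (ρ x) ∙ iter (suc n) ρ x  ∎

    orbitSum-Fix : ∀ n {g} → Fix ρ g → orbitSum n g ≈ n · g
    orbitSum-Fix zero    fg = refl
    orbitSum-Fix (suc n) fg = ∙-congˡ (trans (cong (orbitSum-endo n) fg) (orbitSum-Fix n fg))

    norm : Carrier → Carrier
    norm = orbitSum q

    norm-ρ : ∀ x → norm (ρ x) ≈ norm x
    norm-ρ x = begin
      norm (ρ x)                   ≈⟨ xyx⁻¹≈y x _ ⟨
      x ∙ norm (ρ x) - x           ≈⟨ ∙-congʳ (orbitSum-sucʳ q x) ⟩
      norm x ∙ iter q ρ x - x      ≈⟨ ∙-congʳ (∙-congˡ (ρ^q≈id x)) ⟩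
      norm x ∙ x - x               ≈⟨ //-rightDividesʳ x (norm x) ⟩
      norm x                       ∎

    average : Carrier → Carrier
    average x = divide (norm x)

    average-endo : IsEndomorphism average
    average-endo = ∘-endo divide-endo (orbitSum-endo q)

    average-Fix : ∀ x → Fix ρ (average x)
    average-Fix x = begin
      ρ (divide (norm x))  ≈⟨ divide-commute ρ-endo (norm x) ⟨
      divide (ρ (norm x))  ≈⟨ cong divide-endo (trans (ρ-orbitSum q x) (norm-ρ x)) ⟩
      divide (norm x)      ∎

    average-id : ∀ {g} → Fix ρ g → average g ≈ g
    average-id fg = trans (cong divide-endo (orbitSum-Fix q fg)) (divide-· _)

    average-iter : ∀ n x → average (iter n ρ x) ≈ average x
    average-iter zero    x = refl
    average-iter (suc n) x = trans (cong divide-endo (norm-ρ _)) (average-iter n x)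

    1-average : Carrier → Carrier
    1-average x = x - average x

    1-average-endo : IsEndomorphism 1-average
    1-average-endo = -‿endo id-endo average-endo

    1-ρ : Carrier → Carrier
    1-ρ z = z - ρ z

    1-ρ-endo : IsEndomorphism 1-ρ
    1-ρ-endo = -‿endo id-endo ρ-endo

    average-1-ρ : ∀ z → average (1-ρ z) ≈ ε
    average-1-ρ z = trans (-‿homo average-endo z (ρ z))
                          (x≈y⇒x∙y⁻¹≈ε (sym (average-iter 1 z)))

    1-ρ-orbitSum : ∀ n x → 1-ρ (orbitSum n x) ≈ x - iter n ρ x
    1-ρ-orbitSum n x = trans (∙-congˡ (⁻¹-cong (ρ-orbitSum n x)))
                             (-‿exchange (orbitSum-sucʳ n x))

    partialOrbitSums : ℕ → Carrier → Carrier
    partialOrbitSums zero    x = ε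
    partialOrbitSums (suc n) x = orbitSum n x ∙ partialOrbitSums n x

    partialOrbitSums-endo : ∀ n → IsEndomorphism (partialOrbitSums n)
    partialOrbitSums-endo zero    = record { cong = λ _ → refl ; homo = λ _ _ → sym (identityˡ ε) }
    partialOrbitSums-endo (suc n) = ∙-endo (orbitSum-endo n) (partialOrbitSums-endo n)

    1-ρ-partialOrbitSums : ∀ n x → 1-ρ (partialOrbitSums n x) ≈ n · x - orbitSum n x
    1-ρ-partialOrbitSums zero    x = trans (ε-homo 1-ρ-endo) (sym (inverseʳ ε))
    1-ρ-partialOrbitSums (suc n) x = begin
      1-ρ (orbitSum n x ∙ partialOrbitSums n x)
        ≈⟨ homo 1-ρ-endo _ _ ⟩
      1-ρ (orbitSum n x) ∙ 1-ρ (partialOrbitSums n x)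
        ≈⟨ ∙-cong (1-ρ-orbitSum n x) (1-ρ-partialOrbitSums n x) ⟩
      (x - iter n ρ x) ∙ (n · x - orbitSum n x)
        ≈⟨ -‿interchange _ _ _ _ ⟩
      (x ∙ n · x) - (iter n ρ x ∙ orbitSum n x)
        ≈⟨ ∙-congˡ (⁻¹-cong (trans (comm _ _) (sym (orbitSum-sucʳ n x)))) ⟩
      suc n · x - orbitSum (suc n) x
        ∎

    potential : Carrier → Carrier
    potential x = divide (partialOrbitSums q x)

    potential-endo : IsEndomorphism potential
    potential-endo = ∘-endo divide-endo (partialOrbitSums-endo q)

    1-average≈1-ρ∘potential : ∀ x → 1-average x ≈ 1-ρ (potential x)
    1-average≈1-ρ∘potential x = begin
      x - average x                              ≈⟨ ∙-cong (divide-· x) refl ⟨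
      divide (q · x) - divide (norm x)           ≈⟨ -‿homo divide-endo _ _ ⟨
      divide (q · x - norm x)                    ≈⟨ cong divide-endo (1-ρ-partialOrbitSums q x) ⟨
      divide (1-ρ (partialOrbitSums q x))        ≈⟨ divide-commute 1-ρ-endo _ ⟩
      1-ρ (potential x)                          ∎

    average-1-average : ∀ x → average (1-average x) ≈ ε
    average-1-average x = trans (cong average-endo (1-average≈1-ρ∘potential x)) (average-1-ρ _)

    1-average-idempotent : ∀ x → 1-average (1-average x) ≈ 1-average x
    1-average-idempotent x = begin
      1-average x - average (1-average x)  ≈⟨ ∙-congˡ (⁻¹-cong (average-1-average x)) ⟩
      1-average x - ε                      ≈⟨ ∙-congˡ ε⁻¹≈ε ⟩
      1-average x ∙ ε                      ≈⟨ identityʳ _ ⟩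
      1-average x                          ∎

    1-average-Fix : ∀ {g} → Fix ρ g → 1-average g ≈ ε
    1-average-Fix fg = x≈y⇒x∙y⁻¹≈ε (sym (average-id fg))

    average-decomposition : ∀ x → x ≈ average x ∙ 1-average x
    average-decomposition x = sym (trans (comm _ _) (//-rightDividesˡ (average x) x))

module DihedralModule {c ℓ : Level} {k : ℕ} (M : DModule c ℓ (suc k)) (q-auto : MulIsAuto M (suc k))
  where
  open DModule M
  open Endomorphisms B
  open IsEndomorphism
  open import Algebra.Properties.AbelianGroup B using (xyx⁻¹≈y; x≈y⇒x∙y⁻¹≈ε; //-rightDividesʳ)
  open import Algebra.Properties.CommutativeMonoid.Mult commutativeMonoid
    using () renaming (_×_ to _·_)
  open import Relation.Binary.Reasoning.Setoid setoid

  σ-endo : IsEndomorphism σ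
  σ-endo = record { cong = σ-cong ; homo = σ-hom }

  ρ-endo : IsEndomorphism ρ
  ρ-endo = record { cong = ρ-cong ; homo = ρ-hom }

  mulℕ≈· : ∀ n x → mulℕ M n x ≈ n · x
  mulℕ≈· zero    x = refl
  mulℕ≈· (suc n) x = ∙-congˡ (mulℕ≈· n x)

  q·-injective : ∀ x y → suc k · x ≈ suc k · y → x ≈ y
  q·-injective x y qx≈qy =
    proj₁ q-auto x y (trans (mulℕ≈· (suc k) x) (trans qx≈qy (sym (mulℕ≈· (suc k) y))))

  q·-surjective : ∀ y → ∃[ x ] (suc k · x ≈ y)
  q·-surjective y = let (x , qx≈y) = proj₂ q-auto y in x , trans (sym (mulℕ≈· (suc k) x)) qx≈y

  open Averaging (suc k) ρ-endo ρ^q≈1 q·-injective q·-surjective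

  σρ : Carrier → Carrier
  σρ y = σ (ρ y)

  σρ-endo : IsEndomorphism σρ
  σρ-endo = ∘-endo σ-endo ρ-endo

  ρ⁻¹ : Carrier → Carrier
  ρ⁻¹ = iter k ρ

  ρ⁻¹∘ρ≈id : ∀ x → ρ⁻¹ (ρ x) ≈ x
  ρ⁻¹∘ρ≈id x = trans (reflexive (iter-commute ρ k x)) (ρ^q≈1 x)

  σρ-involutive : ∀ y → σρ (σρ y) ≈ y
  σρ-involutive y = begin
    σ (ρ (σρ y))    ≈⟨ σρ≈ρ⁻¹σ (σρ y) ⟩
    ρ⁻¹ (σ (σρ y))  ≈⟨ cong (iter-endo ρ-endo k) (σ²≈1 (ρ y)) ⟩
    ρ⁻¹ (ρ y)       ≈⟨ ρ⁻¹∘ρ≈id y ⟩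
    y               ∎

  σ-preserves-Fixρ : ∀ {g} → Fix ρ g → Fix ρ (σ g)
  σ-preserves-Fixρ {g} fg = trans (ρ-cong (sym ρ⁻¹σg≈σg)) (ρ^q≈1 (σ g))
    where
    ρ⁻¹σg≈σg : ρ⁻¹ (σ g) ≈ σ g
    ρ⁻¹σg≈σg = trans (sym (σρ≈ρ⁻¹σ g)) (σ-cong fg)

  FixD : Carrier → Set ℓ
  FixD x = Fix σ x × Fix ρ x

  FixD⇒B^D : ∀ {x} → FixD x → B^D M x
  FixD⇒B^D (fσ , fρ) i true  = trans (cong (iter-endo ρ-endo i) fσ) (Fix⇒iter-Fix ρ-endo fρ i)
  FixD⇒B^D (fσ , fρ) i false = Fix⇒iter-Fix ρ-endo fρ i

  B^D⇒FixD : ∀ {x} → B^D M x → FixD x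
  B^D⇒FixD d = d 0 true , d 1 false

  FixD-resp : ∀ {x y} → x ≈ y → FixD x → FixD y
  FixD-resp x≈y (fσ , fρ) = Fix-resp σ-endo x≈y fσ , Fix-resp ρ-endo x≈y fρ

  FixD-ε : FixD ε
  FixD-ε = Fix-ε σ-endo , Fix-ε ρ-endo

  FixD-∙ : ∀ {x y} → FixD x → FixD y → FixD (x ∙ y)
  FixD-∙ (fσ , fρ) (gσ , gρ) = Fix-∙ σ-endo fσ gσ , Fix-∙ ρ-endo fρ gρ

  FixD-⁻¹ : ∀ {x} → FixD x → FixD (x ⁻¹)
  FixD-⁻¹ (fσ , fρ) = Fix-⁻¹ σ-endo fσ , Fix-⁻¹ ρ-endo fρ

  FixD⇒Fixσρ : ∀ {x} → FixD x → Fix σρ x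
  FixD⇒Fixσρ (fσ , fρ) = trans (σ-cong fρ) fσ

  Fixσ∩Fixσρ⇒FixD : ∀ {x} → Fix σ x → Fix σρ x → FixD x
  Fixσ∩Fixσρ⇒FixD fσ fσρ = fσ , trans (sym (σ²≈1 _)) (trans (σ-cong fσρ) fσ)

  FixD-summands : ∀ {a b} → Fix σ a → Fix σρ b → FixD (a ∙ b) → FixD a × FixD b
  FixD-summands {a} {b} fa fb fab =
      Fixσ∩Fixσρ⇒FixD fa
        (Fix-resp σρ-endo (//-rightDividesʳ b a) (Fix-‿- σρ-endo (FixD⇒Fixσρ fab) fb))
    , Fixσ∩Fixσρ⇒FixD (Fix-resp σ-endo b≈ab-a (Fix-‿- σ-endo (proj₁ fab) fa)) fb
    where
    b≈ab-a : a ∙ b - a ≈ b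
    b≈ab-a = trans (∙-congʳ (comm a b)) (//-rightDividesʳ a b)

  average-σ : ∀ x → average (σ x) ≈ σ (average x)
  average-σ x = begin
    average (σ x)                                        ≈⟨ cong average∘σ (average-decomposition x) ⟩
    average (σ (average x ∙ 1-average x))                ≈⟨ homo average∘σ _ _ ⟩
    average (σ (average x)) ∙ average (σ (1-average x))  ≈⟨ ∙-cong σ-average-Fix average-σ-1-average ⟩
    σ (average x) ∙ ε                                    ≈⟨ identityʳ _ ⟩
    σ (average x)                                        ∎
    where
    y = potential x
    average∘σ = ∘-endo average-endo σ-endo
    σ-average-Fix : average (σ (average x)) ≈ σ (average x)
    σ-average-Fix = average-id (σ-preserves-Fixρ (average-Fix x))
    -- σ turns 1 - ρ into 1 - ρ⁻¹ (as σρ = ρ⁻¹σ), whose values are killed by averaging too.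
    average-σ-1-average : average (σ (1-average x)) ≈ ε
    average-σ-1-average = begin
      average (σ (1-average x))            ≈⟨ cong average∘σ (1-average≈1-ρ∘potential x) ⟩
      average (σ (y - ρ y))                ≈⟨ -‿homo average∘σ y (ρ y) ⟩
      average (σ y) - average (σ (ρ y))    ≈⟨ ∙-congˡ (⁻¹-cong (cong average-endo (σρ≈ρ⁻¹σ y))) ⟩
      average (σ y) - average (ρ⁻¹ (σ y))  ≈⟨ x≈y⇒x∙y⁻¹≈ε (sym (average-iter k (σ y))) ⟩
      ε                                    ∎

  average-Fixσ : ∀ {s} → Fix σ s → FixD (average s)
  average-Fixσ {s} fs = trans (sym (average-σ s)) (cong average-endo fs) , average-Fix s

  average-Fixσρ : ∀ {t} → Fix σρ t → FixD (average t)
  average-Fixσρ {t} ft = σ-fixed , average-Fix t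
    where
    σt≈ρt : σ t ≈ ρ t
    σt≈ρt = trans (σ-cong (sym ft)) (σ²≈1 (ρ t))
    σ-fixed : σ (average t) ≈ average t
    σ-fixed = begin
      σ (average t)      ≈⟨ average-σ t ⟨
      average (σ t)      ≈⟨ cong average-endo σt≈ρt ⟩
      average (ρ t)      ≈⟨ average-iter 1 t ⟩
      average t          ∎

  average-B^Σ+B^Σ' : ∀ {x} → B^Σ+B^Σ' M x → FixD (average x)
  average-B^Σ+B^Σ' (s , t , s∈B^Σ , t∈B^Σ' , x≈s∙t) =
    FixD-resp (sym (trans (cong average-endo x≈s∙t) (homo average-endo s t)))
              (FixD-∙ (average-Fixσ (s∈B^Σ 1)) (average-Fixσρ (t∈B^Σ' 1)))

  σ-part σρ-part : Carrier → Carrier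
  σ-part  x = (σρ (potential x) ∙ ρ (potential x)) ⁻¹
  σρ-part x = σρ (potential x) ∙ potential x

  σ-part-endo : IsEndomorphism σ-part
  σ-part-endo = ⁻¹-endo (∙-endo (∘-endo σρ-endo potential-endo) (∘-endo ρ-endo potential-endo))

  σρ-part-endo : IsEndomorphism σρ-part
  σρ-part-endo = ∙-endo (∘-endo σρ-endo potential-endo) potential-endo

  σ-part-Fix : ∀ x → Fix σ (σ-part x)
  σ-part-Fix x = Fix-⁻¹ σ-endo (involution⇒Fix-∙ σ-endo σ²≈1 (ρ (potential x)))

  σρ-part-Fix : ∀ x → Fix σρ (σρ-part x)
  σρ-part-Fix x = involution⇒Fix-∙ σρ-endo σρ-involutive (potential x)

  1-ρ-splitting : ∀ y → 1-ρ y ≈ (σρ y ∙ ρ y) ⁻¹ ∙ (σρ y ∙ y)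
  1-ρ-splitting y = sym (begin
    (σρ y ∙ ρ y) ⁻¹ ∙ (σρ y ∙ y)     ≈⟨ comm _ _ ⟩
    (σρ y ∙ y) - (σρ y ∙ ρ y)        ≈⟨ -‿interchange _ _ _ _ ⟨
    (σρ y - σρ y) ∙ (y - ρ y)        ≈⟨ ∙-congʳ (inverseʳ (σρ y)) ⟩
    ε ∙ 1-ρ y                        ≈⟨ identityˡ _ ⟩
    1-ρ y                            ∎)

  1-average≈σ-part∙σρ-part : ∀ x → 1-average x ≈ σ-part x ∙ σρ-part x
  1-average≈σ-part∙σρ-part x = trans (1-average≈1-ρ∘potential x) (1-ρ-splitting (potential x))

  infix 4 _≈ᴰ_
  _≈ᴰ_ : Carrier → Carrier → Set ℓ
  x ≈ᴰ y = B^D M (x - y)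

  ≈⇒≈ᴰ : ∀ {x y} → x ≈ y → x ≈ᴰ y
  ≈⇒≈ᴰ x≈y = FixD⇒B^D (FixD-resp (sym (x≈y⇒x∙y⁻¹≈ε x≈y)) FixD-ε)

  module _ {f : Carrier → Carrier} (f-endo : IsEndomorphism f) where

    FixD-diff⇒≈ᴰ : ∀ {x y} → FixD (f (x - y)) → f x ≈ᴰ f y
    FixD-diff⇒≈ᴰ d = FixD⇒B^D (FixD-resp (-‿homo f-endo _ _) d)

    ≈ᴰ⇒FixD-diff : ∀ {x y} → f x ≈ᴰ f y → FixD (f (x - y))
    ≈ᴰ⇒FixD-diff d = FixD-resp (sym (-‿homo f-endo _ _)) (B^D⇒FixD d)

  B/B^D≅B^G/B^D⊕[B^Σ+B^Σ']/B^D :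
    Iso (Quot M (B^D M))
        (SubQuot M (B^G M) (G-closed M) (B^D M) ⊕ SubQuot M (B^Σ+B^Σ' M) (Σ+Σ'-closed M) (B^D M))
  B/B^D≅B^G/B^D⊕[B^Σ+B^Σ']/B^D = F , F-cong , F-homo , F-injective , F-surjective
    where
    F : Carrier → Σ Carrier (B^G M) × Σ Carrier (B^Σ+B^Σ' M)
    F x = (average x , Fix⇒iter-Fix ρ-endo (average-Fix x))
        , (1-average x , σ-part x , σρ-part x , Fix⇒iter-Fix σ-endo (σ-part-Fix x)
                       , Fix⇒iter-Fix σρ-endo (σρ-part-Fix x) , 1-average≈σ-part∙σρ-part x)

    F-cong : ∀ {x y} → x ≈ᴰ y → average x ≈ᴰ average y × 1-average x ≈ᴰ 1-average y
    F-cong d = FixD-diff⇒≈ᴰ average-endo (FixD-resp (sym (average-id (proj₂ w))) w)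
             , FixD-diff⇒≈ᴰ 1-average-endo (FixD-resp (sym (1-average-Fix (proj₂ w))) FixD-ε)
      where w = B^D⇒FixD d

    F-homo : ∀ x y → average (x ∙ y) ≈ᴰ average x ∙ average y
                   × 1-average (x ∙ y) ≈ᴰ 1-average x ∙ 1-average y
    F-homo x y = ≈⇒≈ᴰ (homo average-endo x y) , ≈⇒≈ᴰ (homo 1-average-endo x y)

    F-injective : ∀ {x y} → average x ≈ᴰ average y × 1-average x ≈ᴰ 1-average y → x ≈ᴰ y
    F-injective (d , d') = FixD⇒B^D (FixD-resp (sym (average-decomposition _))
      (FixD-∙ (≈ᴰ⇒FixD-diff average-endo d) (≈ᴰ⇒FixD-diff 1-average-endo d')))

    F-surjective : ∀ z → ∃[ x ] (average x ≈ᴰ proj₁ (proj₁ z) × 1-average x ≈ᴰ proj₁ (proj₂ z))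
    F-surjective ((a , a∈B^G) , (b , b∈B^Σ+B^Σ')) =
        x
      , ≈⇒≈ᴰ average-x≈a
      , FixD⇒B^D (FixD-resp (sym 1-average-x-b≈) (FixD-⁻¹ (average-B^Σ+B^Σ' b∈B^Σ+B^Σ')))
      where
      x = a ∙ 1-average b
      average-x≈a : average x ≈ a
      average-x≈a = begin
        average (a ∙ 1-average b)          ≈⟨ homo average-endo _ _ ⟩
        average a ∙ average (1-average b)  ≈⟨ ∙-cong (average-id (a∈B^G 1)) (average-1-average b) ⟩
        a ∙ ε                              ≈⟨ identityʳ a ⟩
        a                                  ∎
      1-average-x-b≈ : 1-average x - b ≈ average b ⁻¹
      1-average-x-b≈ = begin
        1-average (a ∙ 1-average b) - b            ≈⟨ ∙-congʳ (homo 1-average-endo _ _) ⟩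
        1-average a ∙ 1-average (1-average b) - b  ≈⟨ ∙-congʳ (∙-cong (1-average-Fix (a∈B^G 1))
                                                                       (1-average-idempotent b)) ⟩
        ε ∙ 1-average b - b                        ≈⟨ ∙-congʳ (identityˡ _) ⟩
        b - average b - b                          ≈⟨ xyx⁻¹≈y b _ ⟩
        average b ⁻¹                               ∎

  B/B^G≅B^Σ/B^D⊕B^Σ'/B^D :
    Iso (Quot M (B^G M))
        (SubQuot M (B^Σ M) (Σ-closed M) (B^D M) ⊕ SubQuot M (B^Σ' M) (Σ'-closed M) (B^D M))
  B/B^G≅B^Σ/B^D⊕B^Σ'/B^D = F , F-cong , F-homo , F-injective , F-surjective
    where
    F : Carrier → Σ Carrier (B^Σ M) × Σ Carrier (B^Σ' M)
    F x = (σ-part x , Fix⇒iter-Fix σ-endo (σ-part-Fix x))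
        , (σρ-part x , Fix⇒iter-Fix σρ-endo (σρ-part-Fix x))

    parts-FixD : ∀ w → FixD (1-average w) → FixD (σ-part w) × FixD (σρ-part w)
    parts-FixD w d =
      FixD-summands (σ-part-Fix w) (σρ-part-Fix w) (FixD-resp (1-average≈σ-part∙σρ-part w) d)

    F-cong : ∀ {x y} → B^G M (x - y) → σ-part x ≈ᴰ σ-part y × σρ-part x ≈ᴰ σρ-part y
    F-cong w∈B^G =
      FixD-diff⇒≈ᴰ σ-part-endo (proj₁ parts) , FixD-diff⇒≈ᴰ σρ-part-endo (proj₂ parts)
      where parts = parts-FixD _ (FixD-resp (sym (1-average-Fix (w∈B^G 1))) FixD-ε)

    F-homo : ∀ x y → σ-part (x ∙ y) ≈ᴰ σ-part x ∙ σ-part y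
                   × σρ-part (x ∙ y) ≈ᴰ σρ-part x ∙ σρ-part y
    F-homo x y = ≈⇒≈ᴰ (homo σ-part-endo x y) , ≈⇒≈ᴰ (homo σρ-part-endo x y)

    F-injective : ∀ {x y} → σ-part x ≈ᴰ σ-part y × σρ-part x ≈ᴰ σρ-part y → B^G M (x - y)
    F-injective (d , d') = Fix⇒iter-Fix ρ-endo (Fix-resp ρ-endo (sym (average-decomposition _))
      (Fix-∙ ρ-endo (average-Fix _) (proj₂ (FixD-resp (sym (1-average≈σ-part∙σρ-part _))
        (FixD-∙ (≈ᴰ⇒FixD-diff σ-part-endo d) (≈ᴰ⇒FixD-diff σρ-part-endo d'))))))

    F-surjective : ∀ z → ∃[ x ] (σ-part x ≈ᴰ proj₁ (proj₁ z) × σρ-part x ≈ᴰ proj₁ (proj₂ z))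
    F-surjective ((s , s∈B^Σ) , (t , t∈B^Σ')) =
      x , FixD⇒B^D (proj₁ parts) , FixD⇒B^D (proj₂ parts)
      where
      x = s ∙ t
      parts-gap : (σ-part x - s) ∙ (σρ-part x - t) ≈ average x ⁻¹
      parts-gap = begin
        (σ-part x - s) ∙ (σρ-part x - t)  ≈⟨ -‿interchange _ _ _ _ ⟩
        (σ-part x ∙ σρ-part x) - x        ≈⟨ ∙-congʳ (1-average≈σ-part∙σρ-part x) ⟨
        x - average x - x                 ≈⟨ xyx⁻¹≈y x _ ⟩
        average x ⁻¹                      ∎
      parts : FixD (σ-part x - s) × FixD (σρ-part x - t)
      parts = FixD-summands (Fix-‿- σ-endo (σ-part-Fix x) (s∈B^Σ 1))
                            (Fix-‿- σρ-endo (σρ-part-Fix x) (t∈B^Σ' 1))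
                            (FixD-resp (sym parts-gap)
                              (FixD-⁻¹ (average-B^Σ+B^Σ' (s , t , s∈B^Σ , t∈B^Σ' , refl))))

lemma2p7 : {c ℓ : Level} (q : ℕ) → 3 ≤ q → q % 2 ≡ 1
    → (M : DModule c ℓ q) → IsFinite M → MulIsAuto M q
    → Iso (Quot M (B^D M))
          (SubQuot M (B^G M) (G-closed M) (B^D M) ⊕ SubQuot M (B^Σ+B^Σ' M) (Σ+Σ'-closed M) (B^D M))
      × Iso (Quot M (B^G M))
          (SubQuot M (B^Σ M) (Σ-closed M) (B^D M) ⊕ SubQuot M (B^Σ' M) (Σ'-closed M) (B^D M))
lemma2p7 (suc k) _ _ M _ q-auto =
  B/B^D≅B^G/B^D⊕[B^Σ+B^Σ']/B^D , B/B^G≅B^Σ/B^D⊕B^Σ'/B^D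
  where open DihedralModule M q-auto
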